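{- Let $d\geq 1$ and let $D$ be an oriented graph of minimum semi-degree $d$ and of order $n=md$, where $2.91082<m<\frac{2}{c}$. If the strong connectivity $k$ of $D$ satisfies $$k\leq \dfrac{2-c m}{2-c}\,d,$$ then $D$ contains at least one directed triangle.
   Context: Digraphs have no loops and no parallel arcs. An oriented graph is a digraph in which for any two distinct vertices $x,y$ at most one of $(x,y),(y,x)$ is an arc. The minimum semi-degree of $D$ is the minimum of its minimum out-degree and its minimum in-degree. A set $S$ of vertices disconnects $D$ if $D-S$ is not strongly connected; the strong connectivity of $D$ is the smallest cardinality of a vertex set disconnecting $D$. A directed triangle is a directed cycle of length $3$. The constant $c$ denotes the minimum constant such that every digraph of order $n$ with minimum out-degree at least $cn$ contains a directed cycle of length at most $3$; it is known that $\frac13\leq c\leq 0.3465$. -}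

module Defs where

open import Data.Nat as ℕ using (ℕ; zero; suc)
open import Data.Bool using (Bool; true; false)
open import Data.Fin using (Fin)
open import Data.Fin.Subset using (Subset; _∈_; _∉_; ∣_∣)
open import Data.List using (length; filterᵇ; allFin)
open import Data.Product using (Σ; ∃; ∃-syntax; _×_; _,_)
open import Data.Sum using (_⊎_)
open import Data.Integer using (+_)
open import Data.Rational as ℚ using (ℚ; _/_)
open import Relation.Binary.PropositionalEquality using (_≡_)
open import Relation.Nullary using (¬_)

-- A digraph on vertex set Fin n: arc relation as a Bool-valued function
-- (so no parallel arcs), with no loops.
record Digraph (n : ℕ) : Set where
  field
    arc    : Fin n → Fin n → Bool
    noLoop : ∀ x → arc x x ≡ false
open Digraph public

IsOriented : ∀ {n} → Digraph n → Set
IsOriented D = ∀ x y → arc D x y ≡ true → arc D y x ≡ false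

outdeg : ∀ {n} → Digraph n → Fin n → ℕ
outdeg {n} D x = length (filterᵇ (λ y → arc D x y) (allFin n))

indeg : ∀ {n} → Digraph n → Fin n → ℕ
indeg {n} D x = length (filterᵇ (λ y → arc D y x) (allFin n))

MinSemiDegree : ∀ {n} → Digraph n → ℕ → Set
MinSemiDegree D d =
  (∀ x → d ℕ.≤ outdeg D x × d ℕ.≤ indeg D x) ×
  (∃[ x ] (outdeg D x ≡ d ⊎ indeg D x ≡ d))

-- Directed paths in D - S (all vertices after the start avoid S).
data PathAvoiding {n} (D : Digraph n) (S : Subset n) : Fin n → Fin n → Set where
  here : ∀ {u} → PathAvoiding D S u u
  step : ∀ {u w v} → arc D u w ≡ true → w ∉ S → PathAvoiding D S w v →
         PathAvoiding D S u v

StrongMinus : ∀ {n} → Digraph n → Subset n → Set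
StrongMinus D S = ∀ u v → u ∉ S → v ∉ S → PathAvoiding D S u v

Disconnects : ∀ {n} → Digraph n → Subset n → Set
Disconnects D S = ¬ StrongMinus D S

StrongConnectivity : ∀ {n} → Digraph n → ℕ → Set
StrongConnectivity {n} D k =
  (∃[ S ] (Disconnects D S × ∣ S ∣ ≡ k)) ×
  (∀ (S : Subset n) → Disconnects D S → k ℕ.≤ ∣ S ∣)

HasDirectedTriangle : ∀ {n} → Digraph n → Set
HasDirectedTriangle D =
  ∃[ x ] ∃[ y ] ∃[ z ] (arc D x y ≡ true × arc D y z ≡ true × arc D z x ≡ true)

HasCycleAtMost3 : ∀ {n} → Digraph n → Set
HasCycleAtMost3 D =
  (∃[ x ] ∃[ y ] (arc D x y ≡ true × arc D y x ≡ true)) ⊎ HasDirectedTriangle D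

ℕtoℚ : ℕ → ℚ
ℕtoℚ n = (+ n) / 1

CHAdmissible : ℚ → Set
CHAdmissible γ = ∀ (N : ℕ) → 1 ℕ.≤ N → (G : Digraph N) →
  (∀ x → γ ℚ.* ℕtoℚ N ℚ.≤ ℕtoℚ (outdeg G x)) → HasCycleAtMost3 G

-- Let S (|S| = k) disconnect D, so that some v ∉ S cannot be reached
-- from some u ∉ S in D - S. Let A be the set of vertices reachable from u in
-- D - S and B the rest of D - S. No arc leaves A except into S, and no arc
-- enters B except from S, so every vertex of A has ≥ d - k out-neighbours in
-- A and every vertex of B has ≥ d - k in-neighbours in B. Since
-- n = |A| + |B| + k, the hypothesis on k forces c|A| + k ≤ d or c|B| + k ≤ d;
-- admissibility of c applied to D[A] (resp. to the reverse of D[B]) yields a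
-- cycle of length ≤ 3, which is a triangle because D is oriented. Since having
-- a triangle is decidable, the lemma follows constructively: a triangle-free D
-- would make D - S strongly connected.

module Submission where

open import Defs
open import Data.Nat as ℕ using (ℕ)
open import Data.Integer using (+_)
open import Data.Rational as ℚ using (ℚ; _/_)
open import Relation.Binary.PropositionalEquality using (_≡_)

open import Data.Nat using (zero; suc; _+_; _∸_; _≤_; _<_; z≤n; s≤s)
import Data.Nat.Properties as ℕP
open import Algebra.Properties.CommutativeSemigroup ℕP.+-commutativeSemigroup
  using (interchange)
import Data.Integer as ℤ
import Data.Integer.Properties as ℤP
open import Data.Nat.Coprimality using (1-coprimeTo) renaming (sym to coprime-sym)
import Data.Rational.Properties as ℚP
open import Data.Rational.Solver using (module +-*-Solver)
open import Data.Bool using (Bool; true; false; _∧_; _∨_; not)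
import Data.Bool.Properties as BoolP
open import Data.Fin using (Fin; zero; suc)
import Data.Fin.Properties as FinP
open import Data.Fin.Subset using (Subset; _∉_; ∣_∣)
import Data.Vec as Vec
open import Data.Vec.Properties using ([]=⇒lookup; lookup⇒[]=)
open import Data.List using (List; []; _∷_; length; filterᵇ; tabulate; allFin; lookup)
open import Data.Product using (∃-syntax; _×_; _,_; proj₁; proj₂)
open import Data.Sum using (_⊎_; inj₁; inj₂; [_,_]′)
open import Function using (_∘_)
open import Relation.Binary.PropositionalEquality
  using (_≢_; refl; sym; trans; cong; cong₂; subst; subst₂; module ≡-Reasoning)
open import Relation.Binary.Construct.Closure.ReflexiveTransitive
  using (Star; ε; _◅_; _◅◅_)
open import Relation.Nullary using (Dec; yes; no; ¬_; contradiction)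
open import Relation.Nullary.Decidable using (does; dec-true; _×-dec_; _→-dec_)

ind : Bool → ℕ
ind true  = 1
ind false = 0

count : ∀ {n} → (Fin n → Bool) → ℕ
count {zero}  p = 0
count {suc n} p = ind (p zero) + count (p ∘ suc)

_⊆ᵇ_ : ∀ {n} → (Fin n → Bool) → (Fin n → Bool) → Set
X ⊆ᵇ Y = ∀ y → X y ≡ true → Y y ≡ true

count-≤ : ∀ {n} (f : Fin n → Bool) → count f ≤ n
count-≤ {zero}  f = z≤n
count-≤ {suc n} f with f zero
... | true  = s≤s (count-≤ (f ∘ suc))
... | false = ℕP.m≤n⇒m≤1+n (count-≤ (f ∘ suc))

count-pos : ∀ {n} (f : Fin n → Bool) y → f y ≡ true → 1 ≤ count f
count-pos f zero    fy rewrite fy = s≤s z≤n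
count-pos f (suc y) fy =
  ℕP.≤-trans (count-pos (f ∘ suc) y fy) (ℕP.m≤n+m (count (f ∘ suc)) (ind (f zero)))

ind-mono : ∀ {a b} → (a ≡ true → b ≡ true) → ind a ≤ ind b
ind-mono {false}         _ = z≤n
ind-mono {true}  {true}  _ = s≤s z≤n
ind-mono {true}  {false} i with i refl
... | ()

count-mono : ∀ {n} (f g : Fin n → Bool) → f ⊆ᵇ g → count f ≤ count g
count-mono {zero}  f g i = z≤n
count-mono {suc n} f g i =
  ℕP.+-mono-≤ (ind-mono (i zero)) (count-mono (f ∘ suc) (g ∘ suc) (i ∘ suc))

count-< : ∀ {n} (f g : Fin n → Bool) → f ⊆ᵇ g →
  ∀ y → g y ≡ true → f y ≡ false → count f < count g
count-< f g i zero gy fy rewrite gy | fy = s≤s (count-mono (f ∘ suc) (g ∘ suc) (i ∘ suc))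
count-< f g i (suc y) gy fy
  rewrite sym (ℕP.+-suc (ind (f zero)) (count (f ∘ suc))) =
  ℕP.+-mono-≤ (ind-mono (i zero)) (count-< (f ∘ suc) (g ∘ suc) (i ∘ suc) y gy fy)

count-+ : ∀ {n} (h f g : Fin n → Bool) → (∀ x → ind (h x) ≡ ind (f x) + ind (g x)) →
  count h ≡ count f + count g
count-+ {zero}  h f g e = refl
count-+ {suc n} h f g e =
  trans (cong₂ _+_ (e zero) (count-+ (h ∘ suc) (f ∘ suc) (g ∘ suc) (e ∘ suc)))
        (interchange (ind (f zero)) (ind (g zero)) (count (f ∘ suc)) (count (g ∘ suc)))

count-+-≤ : ∀ {n} (h f g : Fin n → Bool) → (∀ x → ind (h x) ≤ ind (f x) + ind (g x)) →
  count h ≤ count f + count g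
count-+-≤ {zero}  h f g e = z≤n
count-+-≤ {suc n} h f g e =
  ℕP.≤-trans (ℕP.+-mono-≤ (e zero) (count-+-≤ (h ∘ suc) (f ∘ suc) (g ∘ suc) (e ∘ suc)))
    (ℕP.≤-reflexive
      (interchange (ind (f zero)) (ind (g zero)) (count (f ∘ suc)) (count (g ∘ suc))))

count-∨ : ∀ {n} (f g : Fin n → Bool) → count (λ x → f x ∨ g x) ≤ count f + count g
count-∨ f g = count-+-≤ _ f g (λ x → ind-∨ (f x) (g x))
  where
  ind-∨ : ∀ a b → ind (a ∨ b) ≤ ind a + ind b
  ind-∨ true  b = s≤s z≤n
  ind-∨ false b = ℕP.≤-refl

count-all : ∀ n → count {n} (λ _ → true) ≡ n
count-all zero    = refl
count-all (suc n) = cong suc (count-all n)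

count-partition : ∀ {n} (A s : Fin n → Bool) → (∀ y → A y ≡ true → s y ≡ false) →
  n ≡ count A + count (λ y → not (A y ∨ s y)) + count s
count-partition {n} A s disjoint = begin
  n                                          ≡⟨ sym (count-all n) ⟩
  count {n} (λ _ → true)                     ≡⟨ count-+ _ _ s (λ y → split-s (s y)) ⟩
  count (not ∘ s) + count s                  ≡⟨ cong (_+ count s) (count-+ _ A _ split-A) ⟩
  count A + count (λ y → not (A y ∨ s y)) + count s ∎
  where
  open ≡-Reasoning
  split-s : ∀ b → 1 ≡ ind (not b) + ind b
  split-s true  = refl
  split-s false = refl
  split-A : ∀ y → ind (not (s y)) ≡ ind (A y) + ind (not (A y ∨ s y))
  split-A y with A y in Ay | s y in sy
  ... | false | _     = refl
  ... | true  | false = refl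
  ... | true  | true  with trans (sym sy) (disjoint y Ay)
  ...   | ()

count-subset : ∀ {n} (S : Subset n) → count (Vec.lookup S) ≡ ∣ S ∣
count-subset Vec.[]          = refl
count-subset (true Vec.∷ S)  = cong suc (count-subset S)
count-subset (false Vec.∷ S) = count-subset S

count-tabulate : ∀ {a} {A : Set a} {n} (p : A → Bool) (g : Fin n → A) →
  length (filterᵇ p (tabulate g)) ≡ count (p ∘ g)
count-tabulate {n = zero}  p g = refl
count-tabulate {n = suc n} p g with p (g zero)
... | true  = cong suc (count-tabulate p (g ∘ suc))
... | false = count-tabulate p (g ∘ suc)

count-lookup : ∀ {a} {A : Set a} (g : A → Bool) (xs : List A) →
  count (g ∘ lookup xs) ≡ length (filterᵇ g xs)
count-lookup g []       = refl
count-lookup g (x ∷ xs) with g x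
... | true  = cong suc (count-lookup g xs)
... | false = count-lookup g xs

length-filterᵇ-∧ : ∀ {a} {A : Set a} (P g : A → Bool) (xs : List A) →
  length (filterᵇ g (filterᵇ P xs)) ≡ length (filterᵇ (λ y → P y ∧ g y) xs)
length-filterᵇ-∧ P g []       = refl
length-filterᵇ-∧ P g (x ∷ xs) with P x
... | false = length-filterᵇ-∧ P g xs
... | true  with g x
...   | true  = cong suc (length-filterᵇ-∧ P g xs)
...   | false = length-filterᵇ-∧ P g xs

lookup-filterᵇ : ∀ {a} {A : Set a} (P : A → Bool) (xs : List A)
  (i : Fin (length (filterᵇ P xs))) → P (lookup (filterᵇ P xs) i) ≡ true
lookup-filterᵇ P (x ∷ xs) i with P x in Px
lookup-filterᵇ P (x ∷ xs) i       | false = lookup-filterᵇ P xs i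
lookup-filterᵇ P (x ∷ xs) zero    | true  = Px
lookup-filterᵇ P (x ∷ xs) (suc i) | true  = lookup-filterᵇ P xs i

outdeg-count : ∀ {n} (D : Digraph n) x → outdeg D x ≡ count (arc D x)
outdeg-count D x = count-tabulate (arc D x) (λ y → y)

ℕtoℚ-mkℚ : ∀ n → ℕtoℚ n ≡ ℚ.mkℚ (+ n) 0 (coprime-sym (1-coprimeTo n))
ℕtoℚ-mkℚ n = ℚP.normalize-coprime (coprime-sym (1-coprimeTo n))

ℕtoℚ-+ : ∀ a b → ℕtoℚ (a + b) ≡ ℕtoℚ a ℚ.+ ℕtoℚ b
ℕtoℚ-+ a b rewrite ℕtoℚ-mkℚ a | ℕtoℚ-mkℚ b =
  ℚP./-cong {+ (a + b)} {1}
    (sym (cong₂ ℤ._+_ (ℤP.*-identityʳ (+ a)) (ℤP.*-identityʳ (+ b)))) refl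

ℕtoℚ-mono : ∀ {a b} → a ≤ b → ℕtoℚ a ℚ.≤ ℕtoℚ b
ℕtoℚ-mono {a} {b} a≤b rewrite ℕtoℚ-mkℚ a | ℕtoℚ-mkℚ b =
  ℚ.*≤* (subst₂ ℤ._≤_ (sym (ℤP.*-identityʳ (+ a))) (sym (ℤP.*-identityʳ (+ b))) (ℤ.+≤+ a≤b))

+-cancelʳ-≤ : ∀ k x y → x ℚ.+ k ℚ.≤ y ℚ.+ k → x ℚ.≤ y
+-cancelʳ-≤ k x y le = subst₂ ℚ._≤_ (add-sub x) (add-sub y) (ℚP.+-monoˡ-≤ (ℚ.- k) le)
  where
  open +-*-Solver
  add-sub : ∀ z → z ℚ.+ k ℚ.+ ℚ.- k ≡ z
  add-sub z = solve 2 (λ z k → z :+ k :+ :- k := z) refl z k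

ℕtoℚ-∸ : ∀ x k d → x ℚ.+ ℕtoℚ k ℚ.≤ ℕtoℚ d → x ℚ.≤ ℕtoℚ (d ∸ k)
ℕtoℚ-∸ x k d x+k≤d = +-cancelʳ-≤ (ℕtoℚ k) x (ℕtoℚ (d ∸ k)) (begin
  x ℚ.+ ℕtoℚ k             ≤⟨ x+k≤d ⟩
  ℕtoℚ d                   ≤⟨ ℕtoℚ-mono (subst (d ≤_) (ℕP.+-comm k (d ∸ k)) (ℕP.m≤n+m∸n d k)) ⟩
  ℕtoℚ (d ∸ k + k)         ≡⟨ ℕtoℚ-+ (d ∸ k) k ⟩
  ℕtoℚ (d ∸ k) ℚ.+ ℕtoℚ k  ∎)
  where open ℚP.≤-Reasoning

≤-half : ∀ x y z → x ℚ.+ y ℚ.≤ z ℚ.+ z → x ℚ.≤ z ⊎ y ℚ.≤ z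
≤-half x y z sum≤ with x ℚP.≤? z | y ℚP.≤? z
... | yes x≤z | _       = inj₁ x≤z
... | no  _   | yes y≤z = inj₂ y≤z
... | no  x≰z | no  y≰z =
  contradiction (ℚP.<-≤-trans (ℚP.+-mono-< (ℚP.≰⇒> x≰z) (ℚP.≰⇒> y≰z)) sum≤) (ℚP.<-irrefl refl)

-- The budget inequality: if md = a + b + k and k(2 - c) ≤ (2 - cm)d, then
-- ca + k ≤ d or cb + k ≤ d, because (ca + k) + (cb + k) = c·md + k(2 - c) ≤ 2d.
budget-split : ∀ c m a b k d → m ℚ.* d ≡ a ℚ.+ b ℚ.+ k →
  k ℚ.* (ℕtoℚ 2 ℚ.- c) ℚ.≤ (ℕtoℚ 2 ℚ.- c ℚ.* m) ℚ.* d →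
  c ℚ.* a ℚ.+ k ℚ.≤ d ⊎ c ℚ.* b ℚ.+ k ℚ.≤ d
budget-split c m a b k d md≡ budget = ≤-half _ _ d (begin
  (c ℚ.* a ℚ.+ k) ℚ.+ (c ℚ.* b ℚ.+ k)             ≡⟨ regroup ⟩
  c ℚ.* (a ℚ.+ b ℚ.+ k) ℚ.+ k ℚ.* (ℕtoℚ 2 ℚ.- c)  ≡⟨ cong (λ z → c ℚ.* z ℚ.+ _) (sym md≡) ⟩
  c ℚ.* (m ℚ.* d) ℚ.+ k ℚ.* (ℕtoℚ 2 ℚ.- c)        ≤⟨ ℚP.+-monoʳ-≤ (c ℚ.* (m ℚ.* d)) budget ⟩
  c ℚ.* (m ℚ.* d) ℚ.+ (ℕtoℚ 2 ℚ.- c ℚ.* m) ℚ.* d  ≡⟨ collapse ⟩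
  d ℚ.+ d                                          ∎)
  where
  open ℚP.≤-Reasoning
  open +-*-Solver
  regroup : (c ℚ.* a ℚ.+ k) ℚ.+ (c ℚ.* b ℚ.+ k) ≡ c ℚ.* (a ℚ.+ b ℚ.+ k) ℚ.+ k ℚ.* (ℕtoℚ 2 ℚ.- c)
  regroup = solve 4 (λ c a b k → (c :* a :+ k) :+ (c :* b :+ k)
                               := c :* (a :+ b :+ k) :+ k :* (con (ℕtoℚ 2) :- c)) refl c a b k
  collapse : c ℚ.* (m ℚ.* d) ℚ.+ (ℕtoℚ 2 ℚ.- c ℚ.* m) ℚ.* d ≡ d ℚ.+ d
  collapse = solve 3 (λ c m d → c :* (m :* d) :+ (con (ℕtoℚ 2) :- c :* m) :* d := d :+ d)
                     refl c m d

reverse : ∀ {n} → Digraph n → Digraph n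
reverse D = record { arc = λ x y → arc D y x ; noLoop = noLoop D }

reverse-oriented : ∀ {n} (D : Digraph n) → IsOriented D → IsOriented (reverse D)
reverse-oriented D oriented x y = oriented y x

reverse-triangle : ∀ {n} (D : Digraph n) → HasDirectedTriangle (reverse D) → HasDirectedTriangle D
reverse-triangle D (x , y , z , xy , yz , zx) = x , z , y , zx , yz , xy

members : ∀ {n} → (Fin n → Bool) → List (Fin n)
members {n} P = filterᵇ P (allFin n)

induced : ∀ {n} (D : Digraph n) (P : Fin n → Bool) → Digraph (length (members P))
induced D P = record
  { arc    = λ i j → arc D (lookup (members P) i) (lookup (members P) j)
  ; noLoop = λ i → noLoop D (lookup (members P) i) }

outdeg-induced : ∀ {n} (D : Digraph n) (P : Fin n → Bool) i →
  outdeg (induced D P) i ≡ count (λ y → P y ∧ arc D (lookup (members P) i) y)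
outdeg-induced {n} D P i = begin
  outdeg (induced D P) i                        ≡⟨ outdeg-count (induced D P) i ⟩
  count (arc D x ∘ lookup (members P))          ≡⟨ count-lookup (arc D x) (members P) ⟩
  length (filterᵇ (arc D x) (members P))        ≡⟨ length-filterᵇ-∧ P (arc D x) (allFin n) ⟩
  length (filterᵇ (λ y → P y ∧ arc D x y) (allFin n)) ≡⟨ count-tabulate (λ y → P y ∧ arc D x y) (λ y → y) ⟩
  count (λ y → P y ∧ arc D x y)                  ∎
  where
  open ≡-Reasoning
  x = lookup (members P) i

induced-triangle : ∀ {n} (D : Digraph n) (P : Fin n → Bool) → IsOriented D →
  HasCycleAtMost3 (induced D P) → HasDirectedTriangle D
induced-triangle D P oriented (inj₁ (i , j , ij , ji)) with trans (sym ji) (oriented _ _ ij)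
... | ()
induced-triangle D P oriented (inj₂ (i , j , l , ij , jl , li)) =
  lookup (members P) i , lookup (members P) j , lookup (members P) l , ij , jl , li

dense-set-triangle : ∀ {n} (c : ℚ) → CHAdmissible c → (D : Digraph n) → IsOriented D →
  (P : Fin n → Bool) (δ : ℕ) → (∀ x → P x ≡ true → δ ≤ count (λ y → P y ∧ arc D x y)) →
  (w : Fin n) → P w ≡ true → c ℚ.* ℕtoℚ (count P) ℚ.≤ ℕtoℚ δ → HasDirectedTriangle D
dense-set-triangle {n} c admissible D oriented P δ dense w Pw cP≤δ =
  induced-triangle D P oriented (admissible N N≥1 (induced D P) outdeg-bound)
  where
  N = length (members P)
  N≡|P| : N ≡ count P
  N≡|P| = count-tabulate P (λ y → y)
  N≥1 : 1 ≤ N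
  N≥1 = subst (1 ≤_) (sym N≡|P|) (count-pos P w Pw)
  outdeg-bound : ∀ i → c ℚ.* ℕtoℚ N ℚ.≤ ℕtoℚ (outdeg (induced D P) i)
  outdeg-bound i = ℚP.≤-trans (subst (λ z → c ℚ.* ℕtoℚ z ℚ.≤ ℕtoℚ δ) (sym N≡|P|) cP≤δ)
    (ℕtoℚ-mono (subst (δ ≤_) (sym (outdeg-induced D P i))
      (dense _ (lookup-filterᵇ P (allFin n) i))))

iterate : ∀ {a} {A : Set a} → (A → A) → ℕ → A → A
iterate F zero    X = X
iterate F (suc t) X = F (iterate F t X)

-- Iterating an inflationary monotone operator on sets over Fin n reaches a
-- post-fixed point within n + 1 steps: each step either stabilises or adds
-- an element, and at most n elements can be added.
module Stabilisation {n} (F : (Fin n → Bool) → (Fin n → Bool))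
  (inflationary : ∀ X → X ⊆ᵇ F X)
  (monotone : ∀ X Y → X ⊆ᵇ Y → F X ⊆ᵇ F Y) where

  private
    ⊆ᵇ-or-witness : ∀ (X Y : Fin n → Bool) → X ⊆ᵇ Y ⊎ ∃[ y ] (X y ≡ true × Y y ≡ false)
    ⊆ᵇ-or-witness X Y with FinP.all? (λ y → (X y BoolP.≟ true) →-dec (Y y BoolP.≟ true))
    ... | yes X⊆Y = inj₁ X⊆Y
    ... | no  X⊈Y with FinP.¬∀⟶∃¬ n _ (λ y → (X y BoolP.≟ true) →-dec (Y y BoolP.≟ true)) X⊈Y
    ...   | y , ¬inclusion = inj₂ (y , counterexample (X y) (Y y) ¬inclusion)
      where
      counterexample : ∀ a b → ¬ (a ≡ true → b ≡ true) → a ≡ true × b ≡ false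
      counterexample false b ¬i = contradiction (λ ()) ¬i
      counterexample true true  ¬i = contradiction (λ _ → refl) ¬i
      counterexample true false ¬i = refl , refl

    progress : ∀ X t → F (iterate F t X) ⊆ᵇ iterate F t X ⊎ t ≤ count (iterate F t X)
    progress X zero = inj₂ z≤n
    progress X (suc t) with ⊆ᵇ-or-witness (iterate F (suc t) X) (iterate F t X)
    ... | inj₁ shrinks = inj₁ (λ y e → monotone _ _ shrinks y e)
    ... | inj₂ (y , new , old) with progress X t
    ...   | inj₁ fixed = contradiction (trans (sym (fixed y new)) old) (λ ())
    ...   | inj₂ t≤ = inj₂ (ℕP.≤-trans (s≤s t≤)
                       (count-< _ _ (inflationary (iterate F t X)) y new old))

  stabilises : ∀ X → F (iterate F (suc n) X) ⊆ᵇ iterate F (suc n) X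
  stabilises X with progress X (suc n)
  ... | inj₁ fixed = fixed
  ... | inj₂ n<   = contradiction (ℕP.≤-trans n< (count-≤ _)) ℕP.1+n≰n

anyᵇ : ∀ {n} → (Fin n → Bool) → Bool
anyᵇ {zero}  f = false
anyᵇ {suc n} f = f zero ∨ anyᵇ (f ∘ suc)

anyᵇ-intro : ∀ {n} (f : Fin n → Bool) x → f x ≡ true → anyᵇ f ≡ true
anyᵇ-intro f zero    fx rewrite fx = refl
anyᵇ-intro f (suc x) fx with f zero
... | true  = refl
... | false = anyᵇ-intro (f ∘ suc) x fx

anyᵇ-elim : ∀ {n} (f : Fin n → Bool) → anyᵇ f ≡ true → ∃[ x ] f x ≡ true
anyᵇ-elim {suc n} f e with f zero in f0
... | true  = zero , f0
... | false with anyᵇ-elim (f ∘ suc) e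
...   | x , fx = suc x , fx

∧-elim : ∀ {a b} → a ∧ b ≡ true → a ≡ true × b ≡ true
∧-elim {true} {true} _ = refl , refl

∧-intro : ∀ {a b} → a ≡ true → b ≡ true → a ∧ b ≡ true
∧-intro refl refl = refl

not-∨-elim : ∀ {a b} → not (a ∨ b) ≡ true → a ≡ false × b ≡ false
not-∨-elim {false} {false} _ = refl , refl

not-∨-intro : ∀ {a b} → a ≡ false → b ≡ false → not (a ∨ b) ≡ true
not-∨-intro refl refl = refl

-- Reachability along a boolean relation R on Fin n, computed as the least
-- R-closed set containing the source.
module Reachability {n} (R : Fin n → Fin n → Bool) where

  Reaches : Fin n → Fin n → Set
  Reaches = Star (λ x y → R x y ≡ true)

  grow : (Fin n → Bool) → (Fin n → Bool)
  grow X y = X y ∨ anyᵇ (λ w → X w ∧ R w y)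

  grow-adds-successor : ∀ X w y → X w ≡ true → R w y ≡ true → grow X y ≡ true
  grow-adds-successor X w y Xw Rwy with X y
  ... | true  = refl
  ... | false = anyᵇ-intro _ w (∧-intro Xw Rwy)

  grow-elim : ∀ X y → grow X y ≡ true → X y ≡ true ⊎ ∃[ w ] (X w ≡ true × R w y ≡ true)
  grow-elim X y e with X y
  ... | true  = inj₁ refl
  ... | false with anyᵇ-elim _ e
  ...   | w , XwRwy = inj₂ (w , ∧-elim {X w} XwRwy)

  grow-inflationary : ∀ X → X ⊆ᵇ grow X
  grow-inflationary X y Xy rewrite Xy = refl

  grow-monotone : ∀ X Y → X ⊆ᵇ Y → grow X ⊆ᵇ grow Y
  grow-monotone X Y X⊆Y y e with grow-elim X y e
  ... | inj₁ Xy               = grow-inflationary Y y (X⊆Y y Xy)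
  ... | inj₂ (w , Xw , Rwy)   = grow-adds-successor Y w y (X⊆Y w Xw) Rwy

  open Stabilisation grow grow-inflationary grow-monotone

  singleton : Fin n → Fin n → Bool
  singleton u y = does (y FinP.≟ u)

  reach : Fin n → Fin n → Bool
  reach u = iterate grow (suc n) (singleton u)

  reach-closed : ∀ u w y → reach u w ≡ true → R w y ≡ true → reach u y ≡ true
  reach-closed u w y uw wy = stabilises (singleton u) y (grow-adds-successor (reach u) w y uw wy)

  reach-source : ∀ u → reach u u ≡ true
  reach-source u = iterates-contain (suc n)
    where
    iterates-contain : ∀ t → iterate grow t (singleton u) u ≡ true
    iterates-contain zero    = dec-true (u FinP.≟ u) refl
    iterates-contain (suc t) = grow-inflationary _ u (iterates-contain t)

  reach-sound : ∀ u y → reach u y ≡ true → Reaches u y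
  reach-sound u = iterates-sound (suc n)
    where
    iterates-sound : ∀ t y → iterate grow t (singleton u) y ≡ true → Reaches u y
    iterates-sound zero y e with y FinP.≟ u
    ... | yes refl = ε
    iterates-sound zero y () | no _
    iterates-sound (suc t) y e with grow-elim (iterate grow t (singleton u)) y e
    ... | inj₁ Xy             = iterates-sound t y Xy
    ... | inj₂ (w , Xw , Rwy) = iterates-sound t w Xw ◅◅ (Rwy ◅ ε)

module Avoiding {n} (D : Digraph n) (S : Subset n) where

  inS : Fin n → Bool
  inS = Vec.lookup S

  arcAvoiding : Fin n → Fin n → Bool
  arcAvoiding x y = arc D x y ∧ not (inS y)

  open Reachability arcAvoiding public

  ∉-lookup : ∀ y → inS y ≡ false → y ∉ S
  ∉-lookup y Sy y∈S with trans (sym ([]=⇒lookup y∈S)) Sy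
  ... | ()

  lookup-∉ : ∀ y → y ∉ S → inS y ≡ false
  lookup-∉ y y∉S with inS y in Sy
  ... | false = refl
  ... | true  = contradiction (lookup⇒[]= y S Sy) y∉S

  reaches-path : ∀ {u v} → Reaches u v → PathAvoiding D S u v
  reaches-path ε = here
  reaches-path (e ◅ p) with ∧-elim {arc D _ _} e
  ... | a , notS = step a (∉-lookup _ (BoolP.not-injective notS)) (reaches-path p)

  reaches-avoids : ∀ {u y} → inS u ≡ false → Reaches u y → inS y ≡ false
  reaches-avoids Su ε = Su
  reaches-avoids Su (e ◅ p) =
    reaches-avoids (BoolP.not-injective (proj₂ (∧-elim {arc D _ _} e))) p

-- If every out-neighbour of a vertex of the nonempty set X lies in X or in s,
-- the minimum out-degree is ≥ d and c|X| + |s| ≤ d, then D has a triangle: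
-- every vertex of X has at least d ∸ |s| ≥ c|X| out-neighbours inside X.
closed-set-triangle : ∀ {n} (c : ℚ) → CHAdmissible c → (D : Digraph n) → IsOriented D →
  (d : ℕ) → (∀ x → d ≤ outdeg D x) → (X s : Fin n → Bool) →
  (∀ x y → X x ≡ true → arc D x y ≡ true → s y ≡ false → X y ≡ true) →
  (w : Fin n) → X w ≡ true →
  c ℚ.* ℕtoℚ (count X) ℚ.+ ℕtoℚ (count s) ℚ.≤ ℕtoℚ d → HasDirectedTriangle D
closed-set-triangle c admissible D oriented d mindeg X s closed w Xw budget =
  dense-set-triangle c admissible D oriented X (d ∸ count s) inner-degree w Xw
    (ℕtoℚ-∸ _ (count s) d budget)
  where
  cover : ∀ x → X x ≡ true → arc D x ⊆ᵇ (λ y → (X y ∧ arc D x y) ∨ s y)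
  cover x Xx y xy with s y in sy
  ... | true  = BoolP.∨-zeroʳ _
  ... | false rewrite closed x y Xx xy sy | xy = refl

  inner-degree : ∀ x → X x ≡ true → d ∸ count s ≤ count (λ y → X y ∧ arc D x y)
  inner-degree x Xx = ℕP.m≤n+o⇒m∸n≤o d (count s) (begin
    d                                          ≤⟨ mindeg x ⟩
    outdeg D x                                 ≡⟨ outdeg-count D x ⟩
    count (arc D x)                            ≤⟨ count-mono _ _ (cover x Xx) ⟩
    count (λ y → (X y ∧ arc D x y) ∨ s y)      ≤⟨ count-∨ _ s ⟩
    count (λ y → X y ∧ arc D x y) + count s    ≡⟨ ℕP.+-comm _ (count s) ⟩
    count s + count (λ y → X y ∧ arc D x y)    ∎)
    where open ℕP.≤-Reasoning

-- Arcs leave A only into S and enter B only from S, and the budget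
-- inequality makes D[A] or the reverse of D[B] dense enough for c.
separation-triangle : ∀ {n} (c : ℚ) → CHAdmissible c → (D : Digraph n) → IsOriented D →
  (d k : ℕ) (m : ℚ) → (∀ x → d ≤ outdeg D x × d ≤ indeg D x) → ℕtoℚ n ≡ m ℚ.* ℕtoℚ d →
  ℕtoℚ k ℚ.* (ℕtoℚ 2 ℚ.- c) ℚ.≤ (ℕtoℚ 2 ℚ.- c ℚ.* m) ℚ.* ℕtoℚ d →
  (S : Subset n) → ∣ S ∣ ≡ k → (u v : Fin n) → u ∉ S → v ∉ S →
  Avoiding.reach D S u v ≡ false → HasDirectedTriangle D
separation-triangle {n} c admissible D oriented d k m mindeg n≡md budget S |S|≡k u v u∉S v∉S
  unreachable = [ A-dense , B-dense ]′
    (budget-split c m (ℕtoℚ (count A)) (ℕtoℚ (count B)) (ℕtoℚ (count inS)) (ℕtoℚ d)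
      sizes (subst (λ z → ℕtoℚ z ℚ.* _ ℚ.≤ _) (sym |s|≡k) budget))
  where
  open Avoiding D S
  A B : Fin n → Bool
  A = reach u
  B y = not (A y ∨ inS y)

  |s|≡k : count inS ≡ k
  |s|≡k = trans (count-subset S) |S|≡k

  A-avoids : ∀ y → A y ≡ true → inS y ≡ false
  A-avoids y Ay = reaches-avoids (lookup-∉ u u∉S) (reach-sound u y Ay)

  sizes : m ℚ.* ℕtoℚ d ≡ ℕtoℚ (count A) ℚ.+ ℕtoℚ (count B) ℚ.+ ℕtoℚ (count inS)
  sizes = begin
    m ℚ.* ℕtoℚ d                                 ≡⟨ sym n≡md ⟩
    ℕtoℚ n                                       ≡⟨ cong ℕtoℚ (count-partition A inS A-avoids) ⟩
    ℕtoℚ (count A + count B + count inS)          ≡⟨ ℕtoℚ-+ (count A + count B) (count inS) ⟩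
    ℕtoℚ (count A + count B) ℚ.+ ℕtoℚ (count inS) ≡⟨ cong (ℚ._+ _) (ℕtoℚ-+ (count A) (count B)) ⟩
    ℕtoℚ (count A) ℚ.+ ℕtoℚ (count B) ℚ.+ ℕtoℚ (count inS) ∎
    where open ≡-Reasoning

  A-closed : ∀ x y → A x ≡ true → arc D x y ≡ true → inS y ≡ false → A y ≡ true
  A-closed x y Ax xy Sy = reach-closed u x y Ax (∧-intro xy (cong not Sy))

  B-closed : ∀ x y → B x ≡ true → arc D y x ≡ true → inS y ≡ false → B y ≡ true
  B-closed x y Bx yx Sy = not-∨-intro {A y} (BoolP.¬-not y∉A) Sy
    where
    y∉A : A y ≢ true
    y∉A Ay with not-∨-elim {A x} Bx
    ... | Ax , Sx = contradiction (trans (sym (A-closed y x Ay yx Sx)) Ax) (λ ())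

  Bv : B v ≡ true
  Bv = not-∨-intro {A v} unreachable (lookup-∉ v v∉S)

  A-dense : c ℚ.* ℕtoℚ (count A) ℚ.+ ℕtoℚ (count inS) ℚ.≤ ℕtoℚ d → HasDirectedTriangle D
  A-dense = closed-set-triangle c admissible D oriented d (proj₁ ∘ mindeg) A inS A-closed
              u (reach-source u)

  B-dense : c ℚ.* ℕtoℚ (count B) ℚ.+ ℕtoℚ (count inS) ℚ.≤ ℕtoℚ d → HasDirectedTriangle D
  B-dense small = reverse-triangle D
    (closed-set-triangle c admissible (reverse D) (reverse-oriented D oriented) d
       (proj₂ ∘ mindeg) B inS B-closed v Bv small)

triangle? : ∀ {n} (D : Digraph n) → Dec (HasDirectedTriangle D)
triangle? D = FinP.any? λ x → FinP.any? λ y → FinP.any? λ z →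
  (arc D x y BoolP.≟ true) ×-dec (arc D y z BoolP.≟ true) ×-dec (arc D z x BoolP.≟ true)

triangle-free⇒strong : ∀ {n} (c : ℚ) → CHAdmissible c → (D : Digraph n) → IsOriented D →
  (d k : ℕ) (m : ℚ) → (∀ x → d ≤ outdeg D x × d ≤ indeg D x) → ℕtoℚ n ≡ m ℚ.* ℕtoℚ d →
  ℕtoℚ k ℚ.* (ℕtoℚ 2 ℚ.- c) ℚ.≤ (ℕtoℚ 2 ℚ.- c ℚ.* m) ℚ.* ℕtoℚ d →
  (S : Subset n) → ∣ S ∣ ≡ k → ¬ HasDirectedTriangle D → StrongMinus D S
triangle-free⇒strong c admissible D oriented d k m mindeg n≡md budget S |S|≡k triangle-free
  u v u∉S v∉S with Avoiding.reach D S u v in reached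
... | true  = Avoiding.reaches-path D S (Avoiding.reach-sound D S u v reached)
... | false = contradiction
  (separation-triangle c admissible D oriented d k m mindeg n≡md budget S |S|≡k u v u∉S v∉S reached)
  triangle-free

-- Under the hypotheses of the lemma, any disconnecting set of k vertices
-- forces a triangle; the case split on triangle? makes this constructive.
disconnecting-set-triangle : ∀ {n} (c : ℚ) → CHAdmissible c → (D : Digraph n) → IsOriented D →
  (d k : ℕ) (m : ℚ) → (∀ x → d ≤ outdeg D x × d ≤ indeg D x) → ℕtoℚ n ≡ m ℚ.* ℕtoℚ d →
  ℕtoℚ k ℚ.* (ℕtoℚ 2 ℚ.- c) ℚ.≤ (ℕtoℚ 2 ℚ.- c ℚ.* m) ℚ.* ℕtoℚ d →
  (S : Subset n) → Disconnects D S → ∣ S ∣ ≡ k → HasDirectedTriangle D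
disconnecting-set-triangle c admissible D oriented d k m mindeg n≡md budget S disconnects |S|≡k
  with triangle? D
... | yes triangle      = triangle
... | no  triangle-free = contradiction
  (triangle-free⇒strong c admissible D oriented d k m mindeg n≡md budget S |S|≡k triangle-free)
  disconnects

-- Lemma 2.3.
lemma2p3 : (c : ℚ) → CHAdmissible c →
    (n d k : ℕ) (m : ℚ) (D : Digraph n) →
    1 ℕ.≤ d → IsOriented D → MinSemiDegree D d →
    ℕtoℚ n ≡ m ℚ.* ℕtoℚ d →
    (+ 291082) / 100000 ℚ.< m → c ℚ.* m ℚ.< ℕtoℚ 2 →
    StrongConnectivity D k →
    ℕtoℚ k ℚ.* (ℕtoℚ 2 ℚ.- c) ℚ.≤ (ℕtoℚ 2 ℚ.- c ℚ.* m) ℚ.* ℕtoℚ d →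
    HasDirectedTriangle D
lemma2p3 c admissible n d k m D _ oriented (mindeg , _) n≡md _ _
  ((S , disconnects , |S|≡k) , _) budget =
  disconnecting-set-triangle c admissible D oriented d k m mindeg n≡md budget S disconnects |S|≡k
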